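{- For every positive integer $s$ and every integer $q\ge 0$, the following identities hold (as identities of rational functions in $x$, i.e. for all real $x$ at which the denominators are nonzero): \[ (-1)^{(s+1)q}\,2L_s(x)\sum_{n=0}^{q}(-1)^{(s+1)n}\,n\,F_{2sn}(x)=2qF_{s(2q+1)}(x)+F_{sq}(x)L_{s(q+1)}(x)-\frac{(x^2+4)F_s(x)}{L_s(x)}F_{s(q+1)}(x)F_{sq}(x), \] \[ (-1)^{sq}\,2F_s(x)\sum_{n=0}^{q}(-1)^{sn}\,n\,L_{2sn}(x)=2qF_{s(2q+1)}(x)+F_{sq}(x)L_{s(q+1)}(x)-\frac{L_s(x)}{F_s(x)}F_{s(q+1)}(x)F_{sq}(x). \]
   Context: Fibonacci polynomials: $F_0(x)=0$, $F_1(x)=1$, $F_{n+1}(x)=xF_n(x)+F_{n-1}(x)$. Lucas polynomials: $L_0(x)=2$, $L_1(x)=x$, $L_{n+1}(x)=xL_n(x)+L_{n-1}(x)$.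
   Formalization: The variable $x$ ranges over the rationals at which the relevant denominator is nonzero, instead of over the reals. -}

module Defs where

open import Data.Nat using (ℕ; zero; suc)
open import Data.Rational using (ℚ; 0ℚ; 1ℚ; _+_; _*_; -_)

F : ℕ → ℚ → ℚ
F zero x = 0ℚ
F (suc zero) x = 1ℚ
F (suc (suc n)) x = x * F (suc n) x + F n x

L : ℕ → ℚ → ℚ
L zero x = 1ℚ + 1ℚ
L (suc zero) x = x
L (suc (suc n)) x = x * L (suc n) x + L n x

neg1^ : ℕ → ℚ
neg1^ zero = 1ℚ
neg1^ (suc k) = - neg1^ k

sumTo : ℕ → (ℕ → ℚ) → ℚ
sumTo zero f = f zero
sumTo (suc q) f = sumTo q f + f (suc q)

-- Both sides satisfy the same first-order recurrence in q. Keep the fraction as an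
-- unknown k and write the right-hand side as closedForm k s m t = 2t U_m + W_m - K_m with
-- U_m = F_(2m+s), W_m = F_m L_(m+s), K_m = k F_(m+s) F_m, at m = s q and t = q; then, for
-- n = m + s,
--   closedForm k s n (t + 1) = ε · closedForm k s m t + 2 c (t + 1) G (2n),
-- with ε = (-1)^(s+1), c = L_s, G = F for the first identity and ε = (-1)^s, c = F_s,
-- G = L for the second, which is exactly the recurrence of the signed sum. The only
-- property of k used is k L_s = (x²+4) F_s, resp. k F_s = L_s. The recurrence reduces to
-- the shift identities F_(m+2b) = L_b F_(m+b) - (-1)^b F_m = F_b L_(m+b) + (-1)^b F_m,
-- the doubling F_(2n) = F_n L_n and (x²+4) F_n² = L_(2n) - 2 (-1)^n; each of these is a
-- polynomial identity in F_m, F_(m+1), F_b, F_(b+1) once the addition formula and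
-- Cassini's identity are substituted.

module Submission where

open import Defs
open import Data.Nat using (ℕ; zero; suc; _≤_) renaming (_+_ to _+ℕ_; _*_ to _*ℕ_)
open import Data.Rational using (ℚ; 0ℚ; 1ℚ; _+_; _*_; _-_; -_; _÷_; 1/_; ≢-nonZero)
open import Data.Rational using () renaming (_/_ to _//_)
open import Data.Integer using (+_)
open import Data.Rational.Properties
  using (_≟_; +-*-commutativeRing; +-assoc; *-assoc; *-identityˡ; *-identityʳ; *-inverseˡ; neg-distribˡ-*;
         normalize-coprime; /-cong)
open import Data.Nat.Properties using (*-zeroʳ; *-suc; +-comm)
import Data.Nat.Coprimality as Coprime
import Data.Nat.Tactic.RingSolver as ℕ
import Data.Integer as ℤ
open import Data.Integer.Tactic.RingSolver using () renaming (solve-∀ to ℤ-solve-∀)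
open import Data.Maybe.Base using (Maybe; just; nothing)
open import Data.Product using (_×_; _,_)
open import Level using (0ℓ)
open import Relation.Nullary using (yes; no)
open import Relation.Binary.PropositionalEquality
open import Tactic.RingSolver using (solve-∀)
open import Tactic.RingSolver.Core.AlmostCommutativeRing using (AlmostCommutativeRing; fromCommutativeRing)
open ≡-Reasoning

ℚ-ring : AlmostCommutativeRing 0ℓ 0ℓ
ℚ-ring = fromCommutativeRing +-*-commutativeRing isZero
  where
  isZero : ∀ p → Maybe (0ℚ ≡ p)
  isZero p with 0ℚ ≟ p
  ... | yes 0≡p = just 0≡p
  ... | no _    = nothing

neg1^-+ : ∀ m n → neg1^ (m +ℕ n) ≡ neg1^ m * neg1^ n
neg1^-+ zero    n = sym (*-identityˡ (neg1^ n))
neg1^-+ (suc m) n = trans (cong -_ (neg1^-+ m n)) (neg-distribˡ-* (neg1^ m) (neg1^ n))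

neg1^-square : ∀ n → neg1^ n * neg1^ n ≡ 1ℚ
neg1^-square zero    = refl
neg1^-square (suc n) = trans (neg-square (neg1^ n)) (neg1^-square n)
  where
  neg-square : ∀ p → (- p) * (- p) ≡ p * p
  neg-square = solve-∀ ℚ-ring

[1+q]/1≡q/1+1 : ∀ q → + suc q // 1 ≡ + q // 1 + 1ℚ
[1+q]/1≡q/1+1 q = sym (trans (cong (_+ 1ℚ) (normalize-coprime (Coprime.sym (Coprime.1-coprimeTo q))))
                             (/-cong (trans (+1-denominator (+ q)) (cong +_ (+-comm q 1))) refl))
  where
  +1-denominator : ∀ i → i ℤ.* + 1 ℤ.+ + 1 ℤ.* + 1 ≡ i ℤ.+ + 1
  +1-denominator = ℤ-solve-∀

÷-*-cancel : ∀ p q (q≢0 : q ≢ 0ℚ) → _÷_ p q {{≢-nonZero q≢0}} * q ≡ p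
÷-*-cancel p q q≢0 = begin
  p * 1/ q * q    ≡⟨ *-assoc p (1/ q) q ⟩
  p * (1/ q * q)  ≡⟨ cong (p *_) (*-inverseˡ q) ⟩
  p * 1ℚ          ≡⟨ *-identityʳ p ⟩
  p               ∎
  where instance _ = ≢-nonZero q≢0

a≡b+c⇒b≡a-c : ∀ {a b c} → a ≡ b + c → b ≡ a - c
a≡b+c⇒b≡a-c {b = b} {c} refl = sym (cancel b c)
  where
  cancel : ∀ b c → b + c - c ≡ b
  cancel = solve-∀ ℚ-ring

[m+s]+[m+s] : ∀ m s → m +ℕ s +ℕ (m +ℕ s) ≡ m +ℕ m +ℕ s +ℕ s
[m+s]+[m+s] = ℕ.solve-∀

m+m+s≡s+m+m : ∀ m s → m +ℕ m +ℕ s ≡ s +ℕ m +ℕ m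
m+m+s≡s+m+m = ℕ.solve-∀

s*[1+q] : ∀ s q → s *ℕ suc q ≡ s *ℕ q +ℕ s
s*[1+q] = ℕ.solve-∀

2s*[1+q] : ∀ s q → 2 *ℕ s *ℕ suc q ≡ s *ℕ q +ℕ s +ℕ (s *ℕ q +ℕ s)
2s*[1+q] = ℕ.solve-∀

s*[2q+1] : ∀ s q → s *ℕ (2 *ℕ q +ℕ 1) ≡ s *ℕ q +ℕ s *ℕ q +ℕ s
s*[2q+1] = ℕ.solve-∀

s*[q+1] : ∀ s q → s *ℕ (q +ℕ 1) ≡ s *ℕ q +ℕ s
s*[q+1] = ℕ.solve-∀

alternatingSum-closedForm : ∀ m c (f R : ℕ → ℚ) → R 0 ≡ c * f 0 →
  (∀ q → R (suc q) ≡ neg1^ m * R q + c * f (suc q)) →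
  ∀ q → neg1^ (m *ℕ q) * (c * sumTo q (λ n → neg1^ (m *ℕ n) * f n)) ≡ R q
alternatingSum-closedForm m c f R R₀ Rₛ zero rewrite *-zeroʳ m = trans (unit c (f 0)) (sym R₀)
  where
  unit : ∀ c a → 1ℚ * (c * (1ℚ * a)) ≡ c * a
  unit = solve-∀ ℚ-ring
alternatingSum-closedForm m c f R R₀ Rₛ (suc q) = begin
  σ′ * (c * (S + σ′ * f (suc q)))
    ≡⟨ cong (λ τ → τ * (c * (S + τ * f (suc q)))) σ′≡εσ ⟩
  (ε * σ) * (c * (S + (ε * σ) * f (suc q)))
    ≡⟨ expand ε σ c S (f (suc q)) ⟩
  ε * (σ * (c * S)) + (ε * ε) * (σ * σ) * (c * f (suc q))
    ≡⟨ cong₂ (λ a b → ε * a + b * (c * f (suc q)))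
             (alternatingSum-closedForm m c f R R₀ Rₛ q)
             (cong₂ _*_ (neg1^-square m) (neg1^-square (m *ℕ q))) ⟩
  ε * R q + 1ℚ * 1ℚ * (c * f (suc q))
    ≡⟨ cong (λ z → ε * R q + z) (*-identityˡ (c * f (suc q))) ⟩
  ε * R q + c * f (suc q)
    ≡⟨ sym (Rₛ q) ⟩
  R (suc q) ∎
  where
  ε = neg1^ m
  σ = neg1^ (m *ℕ q)
  σ′ = neg1^ (m *ℕ suc q)
  S = sumTo q (λ n → neg1^ (m *ℕ n) * f n)
  σ′≡εσ : σ′ ≡ ε * σ
  σ′≡εσ = trans (cong neg1^ (*-suc m q)) (neg1^-+ m (m *ℕ q))
  expand : ∀ ε σ c S a → (ε * σ) * (c * (S + (ε * σ) * a)) ≡ ε * (σ * (c * S)) + (ε * ε) * (σ * σ) * (c * a)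
  expand = solve-∀ ℚ-ring

recurrence-from-parts : ∀ ε c t G Uₘ Uₙ Wₘ Wₙ Kₘ Kₙ →
  Uₙ ≡ c * G + ε * Uₘ →
  Wₙ - Kₙ ≡ ε * (Wₘ - Kₘ) - (1ℚ + 1ℚ) * ε * Uₘ →
  (1ℚ + 1ℚ) * (t + 1ℚ) * Uₙ + Wₙ - Kₙ ≡ ε * ((1ℚ + 1ℚ) * t * Uₘ + Wₘ - Kₘ) + (1ℚ + 1ℚ) * c * ((t + 1ℚ) * G)
recurrence-from-parts ε c t G Uₘ _ Wₘ Wₙ Kₘ Kₙ refl W-K = begin
  (1ℚ + 1ℚ) * (t + 1ℚ) * (c * G + ε * Uₘ) + Wₙ - Kₙ
    ≡⟨ +-assoc ((1ℚ + 1ℚ) * (t + 1ℚ) * (c * G + ε * Uₘ)) Wₙ (- Kₙ) ⟩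
  (1ℚ + 1ℚ) * (t + 1ℚ) * (c * G + ε * Uₘ) + (Wₙ - Kₙ)
    ≡⟨ cong (λ z → (1ℚ + 1ℚ) * (t + 1ℚ) * (c * G + ε * Uₘ) + z) W-K ⟩
  (1ℚ + 1ℚ) * (t + 1ℚ) * (c * G + ε * Uₘ) + (ε * (Wₘ - Kₘ) - (1ℚ + 1ℚ) * ε * Uₘ)
    ≡⟨ combine ε c t G Uₘ Wₘ Kₘ ⟩
  ε * ((1ℚ + 1ℚ) * t * Uₘ + Wₘ - Kₘ) + (1ℚ + 1ℚ) * c * ((t + 1ℚ) * G) ∎
  where
  combine : ∀ ε c t G U W K →
    (1ℚ + 1ℚ) * (t + 1ℚ) * (c * G + ε * U) + (ε * (W - K) - (1ℚ + 1ℚ) * ε * U)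
      ≡ ε * ((1ℚ + 1ℚ) * t * U + W - K) + (1ℚ + 1ℚ) * c * ((t + 1ℚ) * G)
  combine = solve-∀ ℚ-ring

-- solve-∀ treats the module parameter x as a constant, so the ring identities below quantify over x again.
module _ (x : ℚ) where

  F-+ : ∀ m n → F (m +ℕ n) x ≡ F m x * F (suc n) x + F (suc m) x * F n x - x * F m x * F n x
  F-suc-+ : ∀ m n → F (suc (m +ℕ n)) x ≡ F (suc m) x * F (suc n) x + F m x * F n x
  F-+ zero n = base x (F n x) (F (suc n) x)
    where
    base : ∀ x c d → c ≡ 0ℚ * d + 1ℚ * c - x * 0ℚ * c
    base = solve-∀ ℚ-ring
  F-+ (suc m) n = trans (F-suc-+ m n) (step x (F m x) (F (suc m) x) (F n x) (F (suc n) x))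
    where
    step : ∀ x a b c d → b * d + a * c ≡ b * d + (x * b + a) * c - x * b * c
    step = solve-∀ ℚ-ring
  F-suc-+ zero n = base (F n x) (F (suc n) x)
    where
    base : ∀ c d → d ≡ 1ℚ * d + 0ℚ * c
    base = solve-∀ ℚ-ring
  F-suc-+ (suc m) n = trans (cong₂ (λ p q → x * p + q) (F-suc-+ m n) (F-+ m n))
                            (step x (F m x) (F (suc m) x) (F n x) (F (suc n) x))
    where
    step : ∀ x a b c d → x * (b * d + a * c) + (a * d + b * c - x * a * c) ≡ (x * b + a) * d + b * c
    step = solve-∀ ℚ-ring

  L-F : ∀ n → L n x ≡ (1ℚ + 1ℚ) * F (suc n) x - x * F n x
  L-F zero          = base x
    where
    base : ∀ x → 1ℚ + 1ℚ ≡ (1ℚ + 1ℚ) * 1ℚ - x * 0ℚ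
    base = solve-∀ ℚ-ring
  L-F (suc zero)    = base x
    where
    base : ∀ x → x ≡ (1ℚ + 1ℚ) * (x * 1ℚ + 0ℚ) - x * 1ℚ
    base = solve-∀ ℚ-ring
  L-F (suc (suc n)) = trans (cong₂ (λ p q → x * p + q) (L-F (suc n)) (L-F n)) (step x (F n x) (F (suc n) x))
    where
    step : ∀ x a b → x * ((1ℚ + 1ℚ) * (x * b + a) - x * b) + ((1ℚ + 1ℚ) * b - x * a)
                   ≡ (1ℚ + 1ℚ) * (x * (x * b + a) + b) - x * (x * b + a)
    step = solve-∀ ℚ-ring

  cassini : ∀ n → neg1^ n ≡ F (suc n) x * F (suc n) x - x * F n x * F (suc n) x - F n x * F n x
  cassini zero    = base x
    where
    base : ∀ x → 1ℚ ≡ 1ℚ * 1ℚ - x * 0ℚ * 1ℚ - 0ℚ * 0ℚ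
    base = solve-∀ ℚ-ring
  cassini (suc n) = trans (cong -_ (cassini n)) (step x (F n x) (F (suc n) x))
    where
    step : ∀ x a b → - (b * b - x * a * b - a * a) ≡ (x * b + a) * (x * b + a) - x * b * (x * b + a) - b * b
    step = solve-∀ ℚ-ring

  F[m+2b]-L*F : ∀ m b → F (m +ℕ b +ℕ b) x ≡ L b x * F (m +ℕ b) x + neg1^ (suc b) * F m x
  F[m+2b]-L*F m b rewrite F-+ (m +ℕ b) b | F-suc-+ m b | F-+ m b | L-F b | cassini b =
    expand x (F m x) (F (suc m) x) (F b x) (F (suc b) x)
    where
    expand : ∀ x a a′ c d → let p = a * d + a′ * c - x * a * c ; p′ = a′ * d + a * c in
      p * d + p′ * c - x * p * c ≡ ((1ℚ + 1ℚ) * d - x * c) * p + (- (d * d - x * c * d - c * c)) * a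
    expand = solve-∀ ℚ-ring

  F[m+2b]-F*L : ∀ m b → F (m +ℕ b +ℕ b) x ≡ F b x * L (m +ℕ b) x + neg1^ b * F m x
  F[m+2b]-F*L m b rewrite F-+ (m +ℕ b) b | L-F (m +ℕ b) | F-suc-+ m b | F-+ m b | cassini b =
    expand x (F m x) (F (suc m) x) (F b x) (F (suc b) x)
    where
    expand : ∀ x a a′ c d → let p = a * d + a′ * c - x * a * c ; p′ = a′ * d + a * c in
      p * d + p′ * c - x * p * c ≡ c * ((1ℚ + 1ℚ) * p′ - x * p) + (d * d - x * c * d - c * c) * a
    expand = solve-∀ ℚ-ring

  F[2n] : ∀ n → F (n +ℕ n) x ≡ F n x * L n x
  F[2n] n rewrite L-F n | F-+ n n = expand x (F n x) (F (suc n) x)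
    where
    expand : ∀ x c d → c * d + d * c - x * c * c ≡ c * ((1ℚ + 1ℚ) * d - x * c)
    expand = solve-∀ ℚ-ring

  [x²+4]F² : ∀ n → (x * x + (+ 4 // 1)) * (F n x * F n x) ≡ L (n +ℕ n) x - (1ℚ + 1ℚ) * neg1^ n
  [x²+4]F² n rewrite L-F (n +ℕ n) | F-suc-+ n n | F-+ n n | cassini n = expand x (F n x) (F (suc n) x)
    where
    expand : ∀ x c d → (x * x + (+ 4 // 1)) * (c * c)
                     ≡ (1ℚ + 1ℚ) * (d * d + c * c) - x * (c * d + d * c - x * c * c)
                       - (1ℚ + 1ℚ) * (d * d - x * c * d - c * c)
    expand = solve-∀ ℚ-ring

  F*L[m+s] : ∀ s m → F m x * L (m +ℕ s) x ≡ F (m +ℕ m +ℕ s) x - neg1^ m * F s x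
  F*L[m+s] s m rewrite +-comm m s | m+m+s≡s+m+m m s = a≡b+c⇒b≡a-c (F[m+2b]-F*L s m)

  F[2n+s]-L*F : ∀ s m → F (m +ℕ s +ℕ (m +ℕ s) +ℕ s) x
                      ≡ L s x * F (m +ℕ s +ℕ (m +ℕ s)) x + neg1^ (suc s) * F (m +ℕ m +ℕ s) x
  F[2n+s]-L*F s m rewrite [m+s]+[m+s] m s = F[m+2b]-L*F (m +ℕ m +ℕ s) s

  F[2n+s]-F*L : ∀ s m → F (m +ℕ s +ℕ (m +ℕ s) +ℕ s) x
                      ≡ F s x * L (m +ℕ s +ℕ (m +ℕ s)) x + neg1^ s * F (m +ℕ m +ℕ s) x
  F[2n+s]-F*L s m rewrite [m+s]+[m+s] m s = F[m+2b]-F*L (m +ℕ m +ℕ s) s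

  closedForm : ℚ → ℕ → ℕ → ℚ → ℚ
  closedForm k s m t = (1ℚ + 1ℚ) * t * F (m +ℕ m +ℕ s) x + F m x * L (m +ℕ s) x - k * F (m +ℕ s) x * F m x

  K-recurrence-Fsum : ∀ {k s} → k * L s x ≡ (x * x + (+ 4 // 1)) * F s x → ∀ m →
    k * F (m +ℕ s +ℕ s) x * F (m +ℕ s) x
      ≡ neg1^ (suc s) * (k * F (m +ℕ s) x * F m x)
        + F s x * (L (m +ℕ s +ℕ (m +ℕ s)) x - (1ℚ + 1ℚ) * neg1^ (m +ℕ s))
  K-recurrence-Fsum {k} {s} hk m = begin
    k * F (n +ℕ s) x * F n x
      ≡⟨ cong (λ z → k * z * F n x) (F[m+2b]-L*F m s) ⟩
    k * (L s x * F n x + ε * F m x) * F n x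
      ≡⟨ regroup k (L s x) (F n x) ε (F m x) ⟩
    ε * (k * F n x * F m x) + k * L s x * (F n x * F n x)
      ≡⟨ cong (λ z → ε * (k * F n x * F m x) + z * (F n x * F n x)) hk ⟩
    ε * (k * F n x * F m x) + (x * x + (+ 4 // 1)) * F s x * (F n x * F n x)
      ≡⟨ cong (λ z → ε * (k * F n x * F m x) + z) (reassoc x (F s x) (F n x * F n x)) ⟩
    ε * (k * F n x * F m x) + F s x * ((x * x + (+ 4 // 1)) * (F n x * F n x))
      ≡⟨ cong (λ z → ε * (k * F n x * F m x) + F s x * z) ([x²+4]F² n) ⟩
    ε * (k * F n x * F m x) + F s x * (L (n +ℕ n) x - (1ℚ + 1ℚ) * neg1^ n) ∎
    where
    n = m +ℕ s
    ε = neg1^ (suc s)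
    regroup : ∀ k l a ε b → k * (l * a + ε * b) * a ≡ ε * (k * a * b) + k * l * (a * a)
    regroup = solve-∀ ℚ-ring
    reassoc : ∀ x c p → (x * x + (+ 4 // 1)) * c * p ≡ c * ((x * x + (+ 4 // 1)) * p)
    reassoc = solve-∀ ℚ-ring

  K-recurrence-Lsum : ∀ {k s} → k * F s x ≡ L s x → ∀ m →
    k * F (m +ℕ s +ℕ s) x * F (m +ℕ s) x
      ≡ neg1^ s * (k * F (m +ℕ s) x * F m x) + L s x * F (m +ℕ s +ℕ (m +ℕ s)) x
  K-recurrence-Lsum {k} {s} hk m = begin
    k * F (n +ℕ s) x * F n x
      ≡⟨ cong (λ z → k * z * F n x) (F[m+2b]-F*L m s) ⟩
    k * (F s x * L n x + ε * F m x) * F n x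
      ≡⟨ regroup k (F s x) (L n x) (F n x) ε (F m x) ⟩
    ε * (k * F n x * F m x) + k * F s x * (F n x * L n x)
      ≡⟨ cong₂ (λ z w → ε * (k * F n x * F m x) + z * w) hk (sym (F[2n] n)) ⟩
    ε * (k * F n x * F m x) + L s x * F (n +ℕ n) x ∎
    where
    n = m +ℕ s
    ε = neg1^ s
    regroup : ∀ k c l a ε b → k * (c * l + ε * b) * a ≡ ε * (k * a * b) + k * c * (a * l)
    regroup = solve-∀ ℚ-ring

  W-K-recurrence-Fsum : ∀ {k s} → k * L s x ≡ (x * x + (+ 4 // 1)) * F s x → ∀ m →
    F (m +ℕ s) x * L (m +ℕ s +ℕ s) x - k * F (m +ℕ s +ℕ s) x * F (m +ℕ s) x
      ≡ neg1^ (suc s) * (F m x * L (m +ℕ s) x - k * F (m +ℕ s) x * F m x)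
        - (1ℚ + 1ℚ) * neg1^ (suc s) * F (m +ℕ m +ℕ s) x
  W-K-recurrence-Fsum {k} {s} hk m = begin
    F n x * L (n +ℕ s) x - k * F (n +ℕ s) x * F n x
      ≡⟨ cong₂ _-_ (F*L[m+s] s n) (K-recurrence-Fsum {k} {s} hk m) ⟩
    (F (n +ℕ n +ℕ s) x - neg1^ n * F s x)
      - (neg1^ (suc s) * Kₘ + F s x * (L (n +ℕ n) x - (1ℚ + 1ℚ) * neg1^ n))
      ≡⟨ eliminate (neg1^ s) (neg1^ m) (neg1^ n) (F s x) (L (n +ℕ n) x) (F (m +ℕ m +ℕ s) x)
                   (F (n +ℕ n +ℕ s) x) Kₘ (F[2n+s]-F*L s m) (neg1^-+ m s) ⟩
    neg1^ (suc s) * (F (m +ℕ m +ℕ s) x - neg1^ m * F s x - Kₘ)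
      - (1ℚ + 1ℚ) * neg1^ (suc s) * F (m +ℕ m +ℕ s) x
      ≡⟨ cong (λ w → neg1^ (suc s) * (w - Kₘ) - (1ℚ + 1ℚ) * neg1^ (suc s) * F (m +ℕ m +ℕ s) x)
              (sym (F*L[m+s] s m)) ⟩
    neg1^ (suc s) * (F m x * L (m +ℕ s) x - Kₘ) - (1ℚ + 1ℚ) * neg1^ (suc s) * F (m +ℕ m +ℕ s) x ∎
    where
    n = m +ℕ s
    Kₘ = k * F n x * F m x
    eliminate : ∀ e σₘ σₙ c G U V K → V ≡ c * G + e * U → σₙ ≡ σₘ * e →
      (V - σₙ * c) - ((- e) * K + c * (G - (1ℚ + 1ℚ) * σₙ))
        ≡ (- e) * (U - σₘ * c - K) - (1ℚ + 1ℚ) * (- e) * U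
    eliminate e σₘ _ c G U _ K refl refl = collapse e σₘ c G U K
      where
      collapse : ∀ e σₘ c G U K →
        (c * G + e * U - σₘ * e * c) - ((- e) * K + c * (G - (1ℚ + 1ℚ) * (σₘ * e)))
          ≡ (- e) * (U - σₘ * c - K) - (1ℚ + 1ℚ) * (- e) * U
      collapse = solve-∀ ℚ-ring

  W-K-recurrence-Lsum : ∀ {k s} → k * F s x ≡ L s x → ∀ m →
    F (m +ℕ s) x * L (m +ℕ s +ℕ s) x - k * F (m +ℕ s +ℕ s) x * F (m +ℕ s) x
      ≡ neg1^ s * (F m x * L (m +ℕ s) x - k * F (m +ℕ s) x * F m x)
        - (1ℚ + 1ℚ) * neg1^ s * F (m +ℕ m +ℕ s) x
  W-K-recurrence-Lsum {k} {s} hk m = begin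
    F n x * L (n +ℕ s) x - k * F (n +ℕ s) x * F n x
      ≡⟨ cong₂ _-_ (F*L[m+s] s n) (K-recurrence-Lsum {k} {s} hk m) ⟩
    (F (n +ℕ n +ℕ s) x - neg1^ n * F s x) - (neg1^ s * Kₘ + L s x * F (n +ℕ n) x)
      ≡⟨ eliminate (neg1^ s) (neg1^ m) (neg1^ n) (F s x) (L s x * F (n +ℕ n) x) (F (m +ℕ m +ℕ s) x)
                   (F (n +ℕ n +ℕ s) x) Kₘ (F[2n+s]-L*F s m) (neg1^-+ m s) ⟩
    neg1^ s * (F (m +ℕ m +ℕ s) x - neg1^ m * F s x - Kₘ) - (1ℚ + 1ℚ) * neg1^ s * F (m +ℕ m +ℕ s) x
      ≡⟨ cong (λ w → neg1^ s * (w - Kₘ) - (1ℚ + 1ℚ) * neg1^ s * F (m +ℕ m +ℕ s) x)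
              (sym (F*L[m+s] s m)) ⟩
    neg1^ s * (F m x * L (m +ℕ s) x - Kₘ) - (1ℚ + 1ℚ) * neg1^ s * F (m +ℕ m +ℕ s) x ∎
    where
    n = m +ℕ s
    Kₘ = k * F n x * F m x
    eliminate : ∀ e σₘ σₙ c P U V K → V ≡ P + (- e) * U → σₙ ≡ σₘ * e →
      (V - σₙ * c) - (e * K + P) ≡ e * (U - σₘ * c - K) - (1ℚ + 1ℚ) * e * U
    eliminate e σₘ _ c P U _ K refl refl = collapse e σₘ c P U K
      where
      collapse : ∀ e σₘ c P U K →
        (P + (- e) * U - σₘ * e * c) - (e * K + P) ≡ e * (U - σₘ * c - K) - (1ℚ + 1ℚ) * e * U
      collapse = solve-∀ ℚ-ring

  closedForm-recurrence-Fsum : ∀ {k s} → k * L s x ≡ (x * x + (+ 4 // 1)) * F s x → ∀ m t →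
    closedForm k s (m +ℕ s) (t + 1ℚ)
      ≡ neg1^ (s +ℕ 1) * closedForm k s m t + (1ℚ + 1ℚ) * L s x * ((t + 1ℚ) * F (m +ℕ s +ℕ (m +ℕ s)) x)
  closedForm-recurrence-Fsum {k} {s} hk m t rewrite +-comm s 1 =
    recurrence-from-parts (neg1^ (suc s)) (L s x) t (F (n +ℕ n) x) (F (m +ℕ m +ℕ s) x) (F (n +ℕ n +ℕ s) x)
      (F m x * L n x) (F n x * L (n +ℕ s) x) (k * F n x * F m x) (k * F (n +ℕ s) x * F n x)
      (F[2n+s]-L*F s m) (W-K-recurrence-Fsum {k} {s} hk m)
    where
    n = m +ℕ s

  closedForm-recurrence-Lsum : ∀ {k s} → k * F s x ≡ L s x → ∀ m t →
    closedForm k s (m +ℕ s) (t + 1ℚ)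
      ≡ neg1^ s * closedForm k s m t + (1ℚ + 1ℚ) * F s x * ((t + 1ℚ) * L (m +ℕ s +ℕ (m +ℕ s)) x)
  closedForm-recurrence-Lsum {k} {s} hk m t =
    recurrence-from-parts (neg1^ s) (F s x) t (L (n +ℕ n) x) (F (m +ℕ m +ℕ s) x) (F (n +ℕ n +ℕ s) x)
      (F m x * L n x) (F n x * L (n +ℕ s) x) (k * F n x * F m x) (k * F (n +ℕ s) x * F n x)
      (F[2n+s]-F*L s m) (W-K-recurrence-Lsum {k} {s} hk m)
    where
    n = m +ℕ s

  closedForm-alternatingSum : ∀ k s e c (G : ℕ → ℚ) →
    (∀ m t → closedForm k s (m +ℕ s) (t + 1ℚ)
               ≡ neg1^ e * closedForm k s m t + (1ℚ + 1ℚ) * c * ((t + 1ℚ) * G (m +ℕ s +ℕ (m +ℕ s)))) →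
    ∀ q → neg1^ (e *ℕ q) * ((1ℚ + 1ℚ) * c * sumTo q (λ n → neg1^ (e *ℕ n) * ((+ n // 1) * G (2 *ℕ s *ℕ n))))
            ≡ closedForm k s (s *ℕ q) (+ q // 1)
  closedForm-alternatingSum k s e c G rec =
    alternatingSum-closedForm e ((1ℚ + 1ℚ) * c) (λ n → (+ n // 1) * G (2 *ℕ s *ℕ n))
                              (λ q → closedForm k s (s *ℕ q) (+ q // 1)) initial step
    where
    initial : closedForm k s (s *ℕ 0) (+ 0 // 1) ≡ (1ℚ + 1ℚ) * c * ((+ 0 // 1) * G (2 *ℕ s *ℕ 0))
    initial rewrite *-zeroʳ s | *-zeroʳ (2 *ℕ s) = vanish (F s x) (L s x) k c (G 0)
      where
      vanish : ∀ a b k c g → (1ℚ + 1ℚ) * 0ℚ * a + 0ℚ * b - k * a * 0ℚ ≡ (1ℚ + 1ℚ) * c * (0ℚ * g)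
      vanish = solve-∀ ℚ-ring
    step : ∀ q → closedForm k s (s *ℕ suc q) (+ suc q // 1)
                   ≡ neg1^ e * closedForm k s (s *ℕ q) (+ q // 1)
                     + (1ℚ + 1ℚ) * c * ((+ suc q // 1) * G (2 *ℕ s *ℕ suc q))
    step q rewrite s*[1+q] s q | 2s*[1+q] s q | [1+q]/1≡q/1+1 q = rec (s *ℕ q) (+ q // 1)

  closedForm-at-multiple : ∀ k s q → closedForm k s (s *ℕ q) (+ q // 1)
    ≡ (1ℚ + 1ℚ) * (+ q // 1) * F (s *ℕ (2 *ℕ q +ℕ 1)) x + F (s *ℕ q) x * L (s *ℕ (q +ℕ 1)) x
      - k * F (s *ℕ (q +ℕ 1)) x * F (s *ℕ q) x
  closedForm-at-multiple k s q rewrite s*[2q+1] s q | s*[q+1] s q = refl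

  signedSum-F[2sn] : ∀ k s q → k * L s x ≡ (x * x + (+ 4 // 1)) * F s x →
    neg1^ ((s +ℕ 1) *ℕ q) * ((1ℚ + 1ℚ) * L s x * sumTo q (λ n → neg1^ ((s +ℕ 1) *ℕ n) * ((+ n // 1) * F (2 *ℕ s *ℕ n) x)))
      ≡ (1ℚ + 1ℚ) * (+ q // 1) * F (s *ℕ (2 *ℕ q +ℕ 1)) x + F (s *ℕ q) x * L (s *ℕ (q +ℕ 1)) x
        - k * F (s *ℕ (q +ℕ 1)) x * F (s *ℕ q) x
  signedSum-F[2sn] k s q hk =
    trans (closedForm-alternatingSum k s (s +ℕ 1) (L s x) (λ i → F i x) (closedForm-recurrence-Fsum {k} {s} hk) q)
          (closedForm-at-multiple k s q)

  signedSum-L[2sn] : ∀ k s q → k * F s x ≡ L s x →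
    neg1^ (s *ℕ q) * ((1ℚ + 1ℚ) * F s x * sumTo q (λ n → neg1^ (s *ℕ n) * ((+ n // 1) * L (2 *ℕ s *ℕ n) x)))
      ≡ (1ℚ + 1ℚ) * (+ q // 1) * F (s *ℕ (2 *ℕ q +ℕ 1)) x + F (s *ℕ q) x * L (s *ℕ (q +ℕ 1)) x
        - k * F (s *ℕ (q +ℕ 1)) x * F (s *ℕ q) x
  signedSum-L[2sn] k s q hk =
    trans (closedForm-alternatingSum k s s (F s x) (λ i → L i x) (closedForm-recurrence-Lsum {k} {s} hk) q)
          (closedForm-at-multiple k s q)

mainTheorem7 : (s q : ℕ) → 1 ≤ s → (x : ℚ) →
    ((hL : L s x ≢ 0ℚ) →
      neg1^ ((s +ℕ 1) *ℕ q) * ((1ℚ + 1ℚ) * L s x * sumTo q (λ n → neg1^ ((s +ℕ 1) *ℕ n) * ((+ n // 1) * F (2 *ℕ s *ℕ n) x)))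
        ≡ (1ℚ + 1ℚ) * (+ q // 1) * F (s *ℕ (2 *ℕ q +ℕ 1)) x + F (s *ℕ q) x * L (s *ℕ (q +ℕ 1)) x
          - (_÷_ ((x * x + (+ 4 // 1)) * F s x) (L s x) {{≢-nonZero hL}}) * F (s *ℕ (q +ℕ 1)) x * F (s *ℕ q) x)
    ×
    ((hF : F s x ≢ 0ℚ) →
      neg1^ (s *ℕ q) * ((1ℚ + 1ℚ) * F s x * sumTo q (λ n → neg1^ (s *ℕ n) * ((+ n // 1) * L (2 *ℕ s *ℕ n) x)))
        ≡ (1ℚ + 1ℚ) * (+ q // 1) * F (s *ℕ (2 *ℕ q +ℕ 1)) x + F (s *ℕ q) x * L (s *ℕ (q +ℕ 1)) x
          - (_÷_ (L s x) (F s x) {{≢-nonZero hF}}) * F (s *ℕ (q +ℕ 1)) x * F (s *ℕ q) x)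
mainTheorem7 s q _ x =
  (λ hL → signedSum-F[2sn] x (_÷_ ((x * x + (+ 4 // 1)) * F s x) (L s x) {{≢-nonZero hL}}) s q
             (÷-*-cancel _ _ hL)) ,
  (λ hF → signedSum-L[2sn] x (_÷_ (L s x) (F s x) {{≢-nonZero hF}}) s q (÷-*-cancel _ _ hF))
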